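{- Let $n$ be a positive integer and let $c_i, x_i$ ($1\le i\le n$) be nonnegative integers with $c_i\in [0, n]$ and $x_i\in [0, n^2]$. Set $C=\sum_{i=1}^nc_i$, $X=\sum_{i=1}^nx_i$ and $t=\frac{X}{n^2}$, and assume $t<1$. Suppose that $(n-c_i-x_i)(n-c_i)\le X$ for each $i$. Then \[C+X\ge n^2\left(\frac{t}{2}+1-\frac{t(1+t)}{2(1-t)}-\left(1-\frac{t}{1-t}\right)\sqrt{t}\right)-2n.\] -}

module Defs where

open import Data.Nat as ℕ using (ℕ; zero; suc)
open import Data.Integer as ℤ using (ℤ; +_)
open import Data.Rational using (ℚ; _/_; 1ℚ; 0ℚ; ½; _+_; _*_; _-_)
open import Data.Fin using (Fin)
open import Data.List using (map; allFin)
open import Data.Nat.ListAction using (sum)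

Σ : ∀ {n} → (Fin n → ℕ) → ℕ
Σ {n} f = sum (map f (allFin n))

ℕ→ℚ : ℕ → ℚ
ℕ→ℚ a = + a / 1

-- a / b as a rational (total: value 0 when b = 0; only used with b > 0)
ratio : ℕ → ℕ → ℚ
ratio a zero = 0ℚ
ratio a (suc b) = + a / suc b

-- Right-hand side of the bound, with the real number √t replaced by a
-- parameter s:  n² (t/2 + 1 - t(1+t)/(2(1-t)) - (1 - t/(1-t)) s) - 2n,
-- where t = X/n², and t/(1-t) = X/(n² - X).
bound : (n X : ℕ) → (s : ℚ) → ℚ
bound n X s =
  let t = ratio X (n ℕ.* n)
      u = ratio X (n ℕ.* n ℕ.∸ X)
  -- t(1+t)/(2(1-t)) = ½ (1+t) · t/(1-t)
  in ℕ→ℚ (n ℕ.* n) * (t * ½ + 1ℚ - ½ * (1ℚ + t) * u - (1ℚ - u) * s) - ℕ→ℚ (2 ℕ.* n)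

-- Write aᵢ = n - cᵢ, N = n² and u = t/(1 - t) = X/(N - X).  For every σ ∈ [0, 1] with σ² ≥ t the
-- hypothesis (aᵢ - xᵢ)aᵢ ≤ X gives aᵢ(N - X) ≤ nσ(N - X) + N(1 - σ)xᵢ; summing over i and dividing by
-- N - X yields Σ aᵢ ≤ N(u + (1 - u)σ), which is the claimed bound (even without the -2n) once C = N - Σ aᵢ
-- and X = tN are substituted.  The irrational √t is replaced by rationals s ≤ √t ≤ s′: the bound is
-- affine in σ, so one of the two always works.
module Submission where

module Embedding where

  open import Data.Empty using (⊥-elim)
  open import Data.Integer as ℤ using (ℤ; +_)
  import Data.Integer.Properties as ℤP
  open import Data.Integer.Tactic.RingSolver using (solve-∀)
  open import Data.Nat as ℕ using (ℕ; suc)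
  import Data.Nat.Properties as ℕP
  open import Data.Rational as ℚ using (ℚ; 0ℚ; 1ℚ; _/_; toℚᵘ; _+_; _*_; _-_; -_; _≤_; _<_)
  import Data.Rational.Properties as ℚP
  open import Data.Rational.Unnormalised as ℚᵘ using (mkℚᵘ; *≡*; *≤*; *<*)
  import Data.Rational.Unnormalised.Properties as ℚᵘP
  open import Relation.Binary.PropositionalEquality
  open import Relation.Nullary using (yes; no)
  open import Defs using (ℕ→ℚ; ratio)

  ℤ→ℚ : ℤ → ℚ
  ℤ→ℚ i = i / 1

  toℚᵘ-ℤ→ℚ : ∀ i → toℚᵘ (ℤ→ℚ i) ℚᵘ.≃ mkℚᵘ i 0
  toℚᵘ-ℤ→ℚ i = ℚP.toℚᵘ-fromℚᵘ (mkℚᵘ i 0)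

  ℤ→ℚ-homo-+ : ∀ i j → ℤ→ℚ (i ℤ.+ j) ≡ ℤ→ℚ i + ℤ→ℚ j
  ℤ→ℚ-homo-+ i j = ℚP.toℚᵘ-injective (begin
    toℚᵘ (ℤ→ℚ (i ℤ.+ j))           ≈⟨ toℚᵘ-ℤ→ℚ (i ℤ.+ j) ⟩
    mkℚᵘ (i ℤ.+ j) 0                ≈⟨ *≡* (cross-multiplied i j) ⟩
    mkℚᵘ i 0 ℚᵘ.+ mkℚᵘ j 0          ≈⟨ ℚᵘP.+-cong (toℚᵘ-ℤ→ℚ i) (toℚᵘ-ℤ→ℚ j) ⟨
    toℚᵘ (ℤ→ℚ i) ℚᵘ.+ toℚᵘ (ℤ→ℚ j) ≈⟨ ℚP.toℚᵘ-homo-+ (ℤ→ℚ i) (ℤ→ℚ j) ⟨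
    toℚᵘ (ℤ→ℚ i + ℤ→ℚ j)           ∎)
    where
    open ℚᵘP.≃-Reasoning
    cross-multiplied : ∀ i j → (i ℤ.+ j) ℤ.* + 1 ≡ (i ℤ.* + 1 ℤ.+ j ℤ.* + 1) ℤ.* + 1
    cross-multiplied = solve-∀

  ℤ→ℚ-homo-* : ∀ i j → ℤ→ℚ (i ℤ.* j) ≡ ℤ→ℚ i * ℤ→ℚ j
  ℤ→ℚ-homo-* i j = ℚP.toℚᵘ-injective (begin
    toℚᵘ (ℤ→ℚ (i ℤ.* j))           ≈⟨ toℚᵘ-ℤ→ℚ (i ℤ.* j) ⟩
    mkℚᵘ i 0 ℚᵘ.* mkℚᵘ j 0          ≈⟨ ℚᵘP.*-cong (toℚᵘ-ℤ→ℚ i) (toℚᵘ-ℤ→ℚ j) ⟨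
    toℚᵘ (ℤ→ℚ i) ℚᵘ.* toℚᵘ (ℤ→ℚ j) ≈⟨ ℚP.toℚᵘ-homo-* (ℤ→ℚ i) (ℤ→ℚ j) ⟨
    toℚᵘ (ℤ→ℚ i * ℤ→ℚ j)           ∎)
    where open ℚᵘP.≃-Reasoning

  ℤ→ℚ-homo‿- : ∀ i → ℤ→ℚ (ℤ.- i) ≡ - ℤ→ℚ i
  ℤ→ℚ-homo‿- i = ℚP.toℚᵘ-injective (begin
    toℚᵘ (ℤ→ℚ (ℤ.- i)) ≈⟨ toℚᵘ-ℤ→ℚ (ℤ.- i) ⟩
    ℚᵘ.- mkℚᵘ i 0       ≈⟨ ℚᵘP.-‿cong (toℚᵘ-ℤ→ℚ i) ⟨
    ℚᵘ.- toℚᵘ (ℤ→ℚ i)   ≈⟨ ℚP.toℚᵘ-homo‿- (ℤ→ℚ i) ⟨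
    toℚᵘ (- ℤ→ℚ i)      ∎)
    where open ℚᵘP.≃-Reasoning

  ℤ→ℚ-homo-sub : ∀ i j → ℤ→ℚ (i ℤ.- j) ≡ ℤ→ℚ i - ℤ→ℚ j
  ℤ→ℚ-homo-sub i j = trans (ℤ→ℚ-homo-+ i (ℤ.- j)) (cong (λ q → ℤ→ℚ i + q) (ℤ→ℚ-homo‿- j))

  ℤ→ℚ-mono-≤ : ∀ {i j} → i ℤ.≤ j → ℤ→ℚ i ≤ ℤ→ℚ j
  ℤ→ℚ-mono-≤ {i} {j} i≤j = ℚP.toℚᵘ-cancel-≤ (begin
    toℚᵘ (ℤ→ℚ i) ≃⟨ toℚᵘ-ℤ→ℚ i ⟩
    mkℚᵘ i 0     ≤⟨ *≤* (ℤP.*-monoʳ-≤-nonNeg (+ 1) i≤j) ⟩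
    mkℚᵘ j 0     ≃⟨ toℚᵘ-ℤ→ℚ j ⟨
    toℚᵘ (ℤ→ℚ j) ∎)
    where open ℚᵘP.≤-Reasoning

  ℤ→ℚ-mono-< : ∀ {i j} → i ℤ.< j → ℤ→ℚ i < ℤ→ℚ j
  ℤ→ℚ-mono-< {i} {j} i<j = ℚP.toℚᵘ-cancel-< (begin-strict
    toℚᵘ (ℤ→ℚ i) ≃⟨ toℚᵘ-ℤ→ℚ i ⟩
    mkℚᵘ i 0     <⟨ *<* (ℤP.*-monoʳ-<-pos (+ 1) i<j) ⟩
    mkℚᵘ j 0     ≃⟨ toℚᵘ-ℤ→ℚ j ⟨
    toℚᵘ (ℤ→ℚ j) ∎)
    where open ℚᵘP.≤-Reasoning

  +-∸ : ∀ {m n} → n ℕ.≤ m → + (m ℕ.∸ n) ≡ + m ℤ.- + n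
  +-∸ {m} {n} n≤m = sym (trans (ℤP.m-n≡m⊖n m n) (ℤP.⊖-≥ n≤m))

  ℕ→ℚ-homo-+ : ∀ m n → ℕ→ℚ (m ℕ.+ n) ≡ ℕ→ℚ m + ℕ→ℚ n
  ℕ→ℚ-homo-+ m n = ℤ→ℚ-homo-+ (+ m) (+ n)

  ℕ→ℚ-homo-* : ∀ m n → ℕ→ℚ (m ℕ.* n) ≡ ℕ→ℚ m * ℕ→ℚ n
  ℕ→ℚ-homo-* m n = trans (cong ℤ→ℚ (ℤP.pos-* m n)) (ℤ→ℚ-homo-* (+ m) (+ n))

  ℕ→ℚ-homo-∸ : ∀ {m n} → n ℕ.≤ m → ℕ→ℚ (m ℕ.∸ n) ≡ ℕ→ℚ m - ℕ→ℚ n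
  ℕ→ℚ-homo-∸ {m} {n} n≤m = trans (cong ℤ→ℚ (+-∸ n≤m)) (ℤ→ℚ-homo-sub (+ m) (+ n))

  ℕ→ℚ-mono-≤ : ∀ {m n} → m ℕ.≤ n → ℕ→ℚ m ≤ ℕ→ℚ n
  ℕ→ℚ-mono-≤ m≤n = ℤ→ℚ-mono-≤ (ℤ.+≤+ m≤n)

  ℕ→ℚ-nonNeg : ∀ n → 0ℚ ≤ ℕ→ℚ n
  ℕ→ℚ-nonNeg n = ℕ→ℚ-mono-≤ {0} {n} ℕ.z≤n

  ℕ→ℚ-mono-< : ∀ {m n} → m ℕ.< n → ℕ→ℚ m < ℕ→ℚ n
  ℕ→ℚ-mono-< m<n = ℤ→ℚ-mono-< (ℤ.+<+ m<n)

  ℕ→ℚ-cancel-< : ∀ {m n} → ℕ→ℚ m < ℕ→ℚ n → m ℕ.< n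
  ℕ→ℚ-cancel-< {m} {n} lt with m ℕ.<? n
  ... | yes m<n = m<n
  ... | no  m≮n = ⊥-elim (ℚP.<-irrefl refl (ℚP.<-≤-trans lt (ℕ→ℚ-mono-≤ (ℕP.≮⇒≥ m≮n))))

  ratio-*-denominator : ∀ m {n} → 0 ℕ.< n → ratio m n * ℕ→ℚ n ≡ ℕ→ℚ m
  ratio-*-denominator m {suc k} _ = ℚP.toℚᵘ-injective (begin
    toℚᵘ (ratio m (suc k) * ℕ→ℚ (suc k))
      ≈⟨ ℚP.toℚᵘ-homo-* (ratio m (suc k)) (ℕ→ℚ (suc k)) ⟩
    toℚᵘ (ratio m (suc k)) ℚᵘ.* toℚᵘ (ℕ→ℚ (suc k))
      ≈⟨ ℚᵘP.*-cong (ℚP.toℚᵘ-fromℚᵘ (mkℚᵘ (+ m) k)) (toℚᵘ-ℤ→ℚ (+ suc k)) ⟩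
    mkℚᵘ (+ m) k ℚᵘ.* mkℚᵘ (+ suc k) 0
      ≈⟨ *≡* cross-multiplied ⟩
    mkℚᵘ (+ m) 0
      ≈⟨ toℚᵘ-ℤ→ℚ (+ m) ⟨
    toℚᵘ (ℕ→ℚ m) ∎)
    where
    open ℚᵘP.≃-Reasoning
    cross-multiplied : (+ m ℤ.* + suc k) ℤ.* + 1 ≡ + m ℤ.* + (suc k ℕ.* 1)
    cross-multiplied = trans (ℤP.*-identityʳ _) (cong (λ d → + m ℤ.* + d) (sym (ℕP.*-identityʳ (suc k))))

  ratio-*-complement : ∀ {m n} → m ℕ.< n → ratio m (n ℕ.∸ m) * (ℕ→ℚ n - ℕ→ℚ m) ≡ ℕ→ℚ m
  ratio-*-complement {m} {n} m<n = trans (cong (ratio m (n ℕ.∸ m) *_) (sym (ℕ→ℚ-homo-∸ (ℕP.<⇒≤ m<n))))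
                                        (ratio-*-denominator m (ℕP.m<n⇒0<n∸m m<n))

  ratio≤⇒≤* : ∀ m {n q} → 0 ℕ.< n → ratio m n ≤ q → ℕ→ℚ m ≤ q * ℕ→ℚ n
  ratio≤⇒≤* m {n} {q} 0<n ratio≤q = subst (_≤ q * ℕ→ℚ n) (ratio-*-denominator m 0<n)
    (ℚP.*-monoʳ-≤-nonNeg (ℕ→ℚ n) {{ℚ.nonNegative (ℕ→ℚ-nonNeg n)}} ratio≤q)

  ratio<1⇒< : ∀ m {n} → 0 ℕ.< n → ratio m n < 1ℚ → m ℕ.< n
  ratio<1⇒< m {n@(suc _)} 0<n ratio<1 = ℕ→ℚ-cancel-< (begin-strict
    ℕ→ℚ m              ≡⟨ ratio-*-denominator m 0<n ⟨
    ratio m n * ℕ→ℚ n  <⟨ ℚP.*-monoˡ-<-pos (ℕ→ℚ n) {{ℚ.positive (ℕ→ℚ-mono-< 0<n)}} ratio<1 ⟩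
    1ℚ * ℕ→ℚ n         ≡⟨ ℚP.*-identityˡ (ℕ→ℚ n) ⟩
    ℕ→ℚ n              ∎)
    where open ℚP.≤-Reasoning

module Estimates where

  open import Data.Empty using (⊥-elim)
  open import Data.List using ([]; _∷_; map; length)
  open import Data.Nat as ℕ using (ℕ)
  open import Data.Nat.ListAction using (sum)
  open import Data.Rational as ℚ using (ℚ; 0ℚ; 1ℚ; ½; _+_; _*_; _-_; -_; _≤_; _<_)
  import Data.Rational.Properties as ℚP
  open import Data.Sum using (_⊎_; inj₁; inj₂)
  open import Level using (0ℓ)
  open import Relation.Binary.PropositionalEquality
  open import Relation.Nullary.Decidable using (Dec; yes; no; dec⇒maybe)
  open import Tactic.RingSolver using (solve-∀)
  open import Tactic.RingSolver.Core.AlmostCommutativeRing using (AlmostCommutativeRing; fromCommutativeRing)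
  open import Defs using (ℕ→ℚ)
  open Embedding using (ℕ→ℚ-homo-+)

  ℚ-ring : AlmostCommutativeRing 0ℓ 0ℓ
  ℚ-ring = fromCommutativeRing ℚP.+-*-commutativeRing (λ p → dec⇒maybe (0ℚ ℚP.≟ p))

  p≤q⇒0≤q-p : ∀ {p q} → p ≤ q → 0ℚ ≤ q - p
  p≤q⇒0≤q-p {p} {q} p≤q = subst (_≤ q - p) (ℚP.+-inverseʳ p) (ℚP.+-monoˡ-≤ (- p) p≤q)

  0≤q-p⇒p≤q : ∀ {p q} → 0ℚ ≤ q - p → p ≤ q
  0≤q-p⇒p≤q {p} {q} 0≤q-p = subst₂ _≤_ (ℚP.+-identityʳ p) (p+[q-p]≡q p q) (ℚP.+-monoʳ-≤ p 0≤q-p)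
    where
    p+[q-p]≡q : ∀ p q → p + (q - p) ≡ q
    p+[q-p]≡q = solve-∀ ℚ-ring

  p<q⇒0<q-p : ∀ {p q} → p < q → 0ℚ < q - p
  p<q⇒0<q-p {p} {q} p<q = subst (_< q - p) (ℚP.+-inverseʳ p) (ℚP.+-monoˡ-< (- p) p<q)

  *-nonNeg : ∀ {p q} → 0ℚ ≤ p → 0ℚ ≤ q → 0ℚ ≤ p * q
  *-nonNeg {p} {q} 0≤p 0≤q = subst (_≤ p * q) (ℚP.*-zeroʳ p) (ℚP.*-monoˡ-≤-nonNeg p {{ℚ.nonNegative 0≤p}} 0≤q)

  0≤p*q⇒0≤q : ∀ {p q} → 0ℚ < p → 0ℚ ≤ p * q → 0ℚ ≤ q
  0≤p*q⇒0≤q {p} {q} 0<p 0≤p*q =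
    ℚP.*-cancelˡ-≤-pos p {{ℚ.positive 0<p}} (subst (_≤ p * q) (sym (ℚP.*-zeroʳ p)) 0≤p*q)

  p*p<1⇒p≤1 : ∀ {p} → p * p < 1ℚ → p ≤ 1ℚ
  p*p<1⇒p≤1 {p} p*p<1 with ℚP.≤-total p 1ℚ
  ... | inj₁ p≤1 = p≤1
  ... | inj₂ 1≤p = ⊥-elim (ℚP.<-irrefl refl (ℚP.<-≤-trans p*p<1 1≤p*p))
    where
    1≤p*p : 1ℚ ≤ p * p
    1≤p*p = ℚP.≤-trans 1≤p (subst (_≤ p * p) (ℚP.*-identityʳ p)
              (ℚP.*-monoˡ-≤-nonNeg p {{ℚ.nonNegative (ℚP.≤-trans (ℚP.nonNegative⁻¹ 1ℚ) 1≤p)}} 1≤p))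

  deficitBound : ℚ → ℚ → ℚ → ℚ
  deficitBound N u σ = N * (u + (1ℚ - u) * σ)

  ≤-deficitBound-of-sign : ∀ {N A u σ} → A ≤ N → 0ℚ ≤ N → 0ℚ ≤ (u - 1ℚ) * (1ℚ - σ)
                         → A ≤ deficitBound N u σ
  ≤-deficitBound-of-sign {N} {A} {u} {σ} A≤N 0≤N 0≤[u-1][1-σ] =
    ℚP.≤-trans A≤N (0≤q-p⇒p≤q (subst (0ℚ ≤_) (excess N u σ) (*-nonNeg 0≤N 0≤[u-1][1-σ])))
    where
    excess : ∀ N u σ → N * ((u - 1ℚ) * (1ℚ - σ)) ≡ N * (u + (1ℚ - u) * σ) - N
    excess = solve-∀ ℚ-ring

  -- When a > nσ, x ≥ a - X/a turns the slack into a concave function of a on [nσ, n] that vanishes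
  -- at a = n and is nonnegative at a = nσ since X ≤ n²σ²; `large` is the polynomial certificate of this.
  deficit-≤ : ∀ {n N a x X σ} → n * n ≡ N → 0ℚ ≤ a → a ≤ n → 0ℚ ≤ x → (a - x) * a ≤ X
            → 0ℚ ≤ σ → σ ≤ 1ℚ → X ≤ σ * σ * N → X ≤ N
            → a * (N - X) ≤ n * σ * (N - X) + N * (1ℚ - σ) * x
  deficit-≤ {n} {a = a} {x} {X} {σ} refl 0≤a a≤n 0≤x [a-x]a≤X 0≤σ σ≤1 X≤σσN X≤N = by-cases (a ℚP.≤? n * σ)
    where
    0≤n = ℚP.≤-trans 0≤a a≤n
    0≤N = *-nonNeg 0≤n 0≤n
    0≤1-σ = p≤q⇒0≤q-p σ≤1
    small : ∀ n a x X σ → (n * σ - a) * (n * n - X) + n * n * (1ℚ - σ) * x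
                        ≡ n * σ * (n * n - X) + n * n * (1ℚ - σ) * x - a * (n * n - X)
    small = solve-∀ ℚ-ring
    large : ∀ n a x X σ
          → n * n * (1ℚ - σ) * (X - (a - x) * a)
            + (n - a) * ((n * n * σ * (1ℚ - σ) + (σ * σ * (n * n) - X)) * (a - n * σ) + n * (σ * σ * (n * n) - X))
          ≡ a * (n * σ * (n * n - X) + n * n * (1ℚ - σ) * x - a * (n * n - X))
    large = solve-∀ ℚ-ring
    by-cases : Dec (a ≤ n * σ) → a * (n * n - X) ≤ n * σ * (n * n - X) + n * n * (1ℚ - σ) * x
    by-cases (yes a≤nσ) = 0≤q-p⇒p≤q (subst (0ℚ ≤_) (small n a x X σ)
      (ℚP.+-mono-≤ (*-nonNeg (p≤q⇒0≤q-p a≤nσ) (p≤q⇒0≤q-p X≤N)) (*-nonNeg (*-nonNeg 0≤N 0≤1-σ) 0≤x)))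
    by-cases (no a≰nσ) = 0≤q-p⇒p≤q (0≤p*q⇒0≤q 0<a (subst (0ℚ ≤_) (large n a x X σ)
      (ℚP.+-mono-≤ (*-nonNeg (*-nonNeg 0≤N 0≤1-σ) (p≤q⇒0≤q-p [a-x]a≤X))
                   (*-nonNeg (p≤q⇒0≤q-p a≤n) (ℚP.+-mono-≤ (*-nonNeg 0≤slope 0≤a-nσ) (*-nonNeg 0≤n 0≤σσN-X))))))
      where
      nσ<a = ℚP.≰⇒> a≰nσ
      0<a = ℚP.≤-<-trans (*-nonNeg 0≤n 0≤σ) nσ<a
      0≤a-nσ = p≤q⇒0≤q-p (ℚP.<⇒≤ nσ<a)
      0≤σσN-X = p≤q⇒0≤q-p X≤σσN
      0≤slope = ℚP.+-mono-≤ (*-nonNeg (*-nonNeg 0≤N 0≤σ) 0≤1-σ) 0≤σσN-X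

  sum-affine-≤ : ∀ {I : Set} (f g : I → ℕ) {α β γ} → (∀ i → ℕ→ℚ (f i) * γ ≤ α + β * ℕ→ℚ (g i))
               → ∀ l → ℕ→ℚ (sum (map f l)) * γ ≤ ℕ→ℚ (length l) * α + β * ℕ→ℚ (sum (map g l))
  sum-affine-≤ f g {α} {β} {γ} _ [] = ℚP.≤-reflexive (empty α β γ)
    where
    empty : ∀ α β γ → 0ℚ * γ ≡ 0ℚ * α + β * 0ℚ
    empty = solve-∀ ℚ-ring
  sum-affine-≤ f g {α} {β} {γ} f≤ (i ∷ l) = begin
    ℕ→ℚ (f i ℕ.+ sum (map f l)) * γ
      ≡⟨ cong (_* γ) (ℕ→ℚ-homo-+ (f i) (sum (map f l))) ⟩
    (ℕ→ℚ (f i) + ℕ→ℚ (sum (map f l))) * γ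
      ≡⟨ ℚP.*-distribʳ-+ γ (ℕ→ℚ (f i)) (ℕ→ℚ (sum (map f l))) ⟩
    ℕ→ℚ (f i) * γ + ℕ→ℚ (sum (map f l)) * γ
      ≤⟨ ℚP.+-mono-≤ (f≤ i) (sum-affine-≤ f g {α} {β} {γ} f≤ l) ⟩
    (α + β * ℕ→ℚ (g i)) + (ℕ→ℚ (length l) * α + β * ℕ→ℚ (sum (map g l)))
      ≡⟨ regroup α β (ℕ→ℚ (g i)) (ℕ→ℚ (length l)) (ℕ→ℚ (sum (map g l))) ⟩
    (1ℚ + ℕ→ℚ (length l)) * α + β * (ℕ→ℚ (g i) + ℕ→ℚ (sum (map g l)))
      ≡⟨ cong₂ (λ p q → p * α + β * q) (ℕ→ℚ-homo-+ 1 (length l)) (ℕ→ℚ-homo-+ (g i) (sum (map g l))) ⟨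
    ℕ→ℚ (ℕ.suc (length l)) * α + β * ℕ→ℚ (g i ℕ.+ sum (map g l)) ∎
    where
    open ℚP.≤-Reasoning
    regroup : ∀ α β G L S → (α + β * G) + (L * α + β * S) ≡ (1ℚ + L) * α + β * (G + S)
    regroup = solve-∀ ℚ-ring

  ≤-deficitBound : ∀ {n N A X u σ} → n * n ≡ N → X < N → u * (N - X) ≡ X
                 → A * (N - X) ≤ n * (n * σ * (N - X)) + N * (1ℚ - σ) * X → A ≤ deficitBound N u σ
  ≤-deficitBound {n} {A = A} {X} {u} {σ} refl X<N u[N-X]≡X A[N-X]≤ =
    ℚP.*-cancelʳ-≤-pos (n * n - X) {{ℚ.positive (p<q⇒0<q-p X<N)}} (begin
      A * (n * n - X)
        ≤⟨ A[N-X]≤ ⟩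
      n * (n * σ * (n * n - X)) + n * n * (1ℚ - σ) * X
        ≡⟨ cong (λ y → n * (n * σ * (n * n - X)) + n * n * (1ℚ - σ) * y) u[N-X]≡X ⟨
      n * (n * σ * (n * n - X)) + n * n * (1ℚ - σ) * (u * (n * n - X))
        ≡⟨ factor n X u σ ⟩
      n * n * (u + (1ℚ - u) * σ) * (n * n - X) ∎)
    where
    open ℚP.≤-Reasoning
    factor : ∀ n X u σ → n * (n * σ * (n * n - X)) + n * n * (1ℚ - σ) * (u * (n * n - X))
                       ≡ n * n * (u + (1ℚ - u) * σ) * (n * n - X)
    factor = solve-∀ ℚ-ring

  -- The main estimate is only available for σ = s′ ≤ 1.  Otherwise N ≤ N(u + (1 - u)σ) already holds,
  -- for σ = s′ if u ≤ 1 and for σ = s ≤ 1 if u ≥ 1.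
  deficitBound-cases : ∀ {N A u s s′} → 0ℚ ≤ N → A ≤ N → s ≤ 1ℚ → (s′ ≤ 1ℚ → A ≤ deficitBound N u s′)
                     → A ≤ deficitBound N u s ⊎ A ≤ deficitBound N u s′
  deficitBound-cases {u = u} {s = s} {s′ = s′} 0≤N A≤N s≤1 ≤-deficitBound-s′
    with ℚP.≤-total s′ 1ℚ | ℚP.≤-total u 1ℚ
  ... | inj₁ s′≤1 | _   = inj₂ (≤-deficitBound-s′ s′≤1)
  ... | inj₂ 1≤s′ | inj₁ u≤1 = inj₂ (≤-deficitBound-of-sign {u = u} {σ = s′} A≤N 0≤N
    (subst (0ℚ ≤_) (flip u s′) (*-nonNeg (p≤q⇒0≤q-p u≤1) (p≤q⇒0≤q-p 1≤s′))))
    where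
    flip : ∀ u σ → (1ℚ - u) * (σ - 1ℚ) ≡ (u - 1ℚ) * (1ℚ - σ)
    flip = solve-∀ ℚ-ring
  ... | inj₂ _    | inj₂ 1≤u = inj₁ (≤-deficitBound-of-sign {u = u} {σ = s} A≤N 0≤N
    (*-nonNeg (p≤q⇒0≤q-p 1≤u) (p≤q⇒0≤q-p s≤1)))

  deficit≤⇒bound≤ : ∀ {N A C X t u T} σ → A + C ≡ N → t * N ≡ X → u * (N - X) ≡ X → 0ℚ ≤ T
                  → A ≤ deficitBound N u σ
                  → N * (t * ½ + 1ℚ - ½ * (1ℚ + t) * u - (1ℚ - u) * σ) - T ≤ C + X
  deficit≤⇒bound≤ {N} {A} {C} {X} {t} {u} {T} σ A+C≡N tN≡X u[N-X]≡X 0≤T A≤deficitBound = begin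
    N * (t * ½ + 1ℚ - ½ * (1ℚ + t) * u - (1ℚ - u) * σ) - T
      ≡⟨ expand N A C X t u σ T ⟩
    C + X - (slack + T) + defect (A + C) (t * N) (u * (N - X))
      ≡⟨ cong₂ (λ p q → C + X - (slack + T) + defect p q (u * (N - X))) A+C≡N tN≡X ⟩
    C + X - (slack + T) + defect N X (u * (N - X))
      ≡⟨ cong (λ r → C + X - (slack + T) + defect N X r) u[N-X]≡X ⟩
    C + X - (slack + T) + defect N X X
      ≡⟨ vanish (C + X) (slack + T) N X u ⟩
    C + X - (slack + T)
      ≤⟨ 0≤q-p⇒p≤q (subst (0ℚ ≤_) (cancel (C + X) (slack + T)) (ℚP.+-mono-≤ (p≤q⇒0≤q-p A≤deficitBound) 0≤T)) ⟩
    C + X ∎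
    where
    open ℚP.≤-Reasoning
    slack = N * (u + (1ℚ - u) * σ) - A
    defect : ℚ → ℚ → ℚ → ℚ
    defect p q r = (N - p) + ½ * (q - X) + ½ * (r - X) - ½ * u * (q - X)
    expand : ∀ N A C X t u σ T
           → N * (t * ½ + 1ℚ - ½ * (1ℚ + t) * u - (1ℚ - u) * σ) - T
           ≡ C + X - ((N * (u + (1ℚ - u) * σ) - A) + T)
             + ((N - (A + C)) + ½ * (t * N - X) + ½ * (u * (N - X) - X) - ½ * u * (t * N - X))
    expand = solve-∀ ℚ-ring
    vanish : ∀ P Q N X u → P - Q + ((N - N) + ½ * (X - X) + ½ * (X - X) - ½ * u * (X - X)) ≡ P - Q
    vanish = solve-∀ ℚ-ring
    cancel : ∀ P Q → Q ≡ P - (P - Q)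
    cancel = solve-∀ ℚ-ring

open import Defs
open import Data.Nat using (ℕ; _≤_; _*_; _+_)
open import Data.Integer using (+_) renaming (_*_ to _*ℤ_; _-_ to _-ℤ_; _≤_ to _≤ℤ_)
open import Data.Rational using (ℚ; 0ℚ; 1ℚ) renaming (_≤_ to _≤ℚ_; _<_ to _<ℚ_; _*_ to _*ℚ_)
open import Data.Fin using (Fin)
open import Data.Sum using (_⊎_)

open import Data.List using ([]; _∷_; map; length; allFin)
import Data.List.Properties as ListP
open import Data.Nat using (zero; suc; z<s; _∸_; _<_)
import Data.Nat.Properties as ℕP
open import Algebra.Properties.CommutativeSemigroup ℕP.+-commutativeSemigroup using (interchange)
open import Data.Nat.ListAction using (sum)
import Data.Rational as ℚ
import Data.Rational.Properties as ℚP
import Data.Sum as Sum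
open import Function using (id; _∘_)
open import Relation.Binary.PropositionalEquality
open Embedding
open Estimates

length-allFin : ∀ n → length (allFin n) ≡ n
length-allFin n = ListP.length-tabulate id

sum-∸+sum : ∀ {I : Set} {n} (c : I → ℕ) → (∀ i → c i ≤ n)
          → ∀ l → sum (map (λ i → n ∸ c i) l) + sum (map c l) ≡ length l * n
sum-∸+sum c c≤n [] = refl
sum-∸+sum {n = n} c c≤n (i ∷ l) = begin
  (n ∸ c i + sum (map (λ i → n ∸ c i) l)) + (c i + sum (map c l))
    ≡⟨ interchange (n ∸ c i) _ (c i) _ ⟩
  (n ∸ c i + c i) + (sum (map (λ i → n ∸ c i) l) + sum (map c l))
    ≡⟨ cong₂ _+_ (ℕP.m∸n+n≡m (c≤n i)) (sum-∸+sum c c≤n l) ⟩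
  n + length l * n ∎
  where open ≡-Reasoning

Σ-∸+Σ : ∀ n (c : Fin n → ℕ) → (∀ i → c i ≤ n) → Σ (λ i → n ∸ c i) + Σ c ≡ n * n
Σ-∸+Σ n c c≤n = trans (sum-∸+sum c c≤n (allFin n)) (cong (_* n) (length-allFin n))

Σ-affine-≤ : ∀ {n} (f g : Fin n → ℕ) α β γ → (∀ i → ℕ→ℚ (f i) *ℚ γ ≤ℚ α ℚ.+ β *ℚ ℕ→ℚ (g i))
           → ℕ→ℚ (Σ f) *ℚ γ ≤ℚ ℕ→ℚ n *ℚ α ℚ.+ β *ℚ ℕ→ℚ (Σ g)
Σ-affine-≤ {n} f g α β γ f≤ =
  subst (λ k → ℕ→ℚ (Σ f) *ℚ γ ≤ℚ ℕ→ℚ k *ℚ α ℚ.+ β *ℚ ℕ→ℚ (Σ g)) (length-allFin n)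
        (sum-affine-≤ f g {α} {β} {γ} f≤ (allFin n))

deficit-hypothesis : ∀ {n c x X} → c ≤ n → ((+ n -ℤ + c) -ℤ + x) *ℤ (+ n -ℤ + c) ≤ℤ + X
                   → (ℕ→ℚ (n ∸ c) ℚ.- ℕ→ℚ x) *ℚ ℕ→ℚ (n ∸ c) ≤ℚ ℕ→ℚ X
deficit-hypothesis {n} {c} {x} {X} c≤n hyp = subst (_≤ℚ ℕ→ℚ X) embedded (ℤ→ℚ-mono-≤ hyp)
  where
  open ≡-Reasoning
  embedded : ℤ→ℚ (((+ n -ℤ + c) -ℤ + x) *ℤ (+ n -ℤ + c)) ≡ (ℕ→ℚ (n ∸ c) ℚ.- ℕ→ℚ x) *ℚ ℕ→ℚ (n ∸ c)
  embedded = begin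
    ℤ→ℚ (((+ n -ℤ + c) -ℤ + x) *ℤ (+ n -ℤ + c)) ≡⟨ cong (λ a → ℤ→ℚ ((a -ℤ + x) *ℤ a)) (+-∸ c≤n) ⟨
    ℤ→ℚ ((+ (n ∸ c) -ℤ + x) *ℤ + (n ∸ c))       ≡⟨ ℤ→ℚ-homo-* (+ (n ∸ c) -ℤ + x) (+ (n ∸ c)) ⟩
    ℤ→ℚ (+ (n ∸ c) -ℤ + x) *ℚ ℕ→ℚ (n ∸ c)       ≡⟨ cong (_*ℚ ℕ→ℚ (n ∸ c)) (ℤ→ℚ-homo-sub (+ (n ∸ c)) (+ x)) ⟩
    (ℕ→ℚ (n ∸ c) ℚ.- ℕ→ℚ x) *ℚ ℕ→ℚ (n ∸ c)      ∎

Σ-deficit-≤ : ∀ n (c x : Fin n → ℕ) {u σ} → (∀ i → c i ≤ n)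
            → (∀ i → ((+ n -ℤ + c i) -ℤ + x i) *ℤ (+ n -ℤ + c i) ≤ℤ + Σ x)
            → ℕ→ℚ (Σ x) <ℚ ℕ→ℚ (n * n) → u *ℚ (ℕ→ℚ (n * n) ℚ.- ℕ→ℚ (Σ x)) ≡ ℕ→ℚ (Σ x)
            → 0ℚ ≤ℚ σ → σ ≤ℚ 1ℚ → ℕ→ℚ (Σ x) ≤ℚ σ *ℚ σ *ℚ ℕ→ℚ (n * n)
            → ℕ→ℚ (Σ (λ i → n ∸ c i)) ≤ℚ deficitBound (ℕ→ℚ (n * n)) u σ
Σ-deficit-≤ n c x {u} {σ} c≤n hyp X<N u[N-X]≡X 0≤σ σ≤1 X≤σσN =
  ≤-deficitBound {ℕ→ℚ n} {u = u} {σ} nn≡N X<N u[N-X]≡X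
    (Σ-affine-≤ (λ i → n ∸ c i) x (ℕ→ℚ n *ℚ σ *ℚ (N ℚ.- X)) (N *ℚ (1ℚ ℚ.- σ)) (N ℚ.- X) term-≤)
  where
  N = ℕ→ℚ (n * n)
  X = ℕ→ℚ (Σ x)
  nn≡N = sym (ℕ→ℚ-homo-* n n)
  term-≤ : ∀ i → ℕ→ℚ (n ∸ c i) *ℚ (N ℚ.- X)
                 ≤ℚ ℕ→ℚ n *ℚ σ *ℚ (N ℚ.- X) ℚ.+ N *ℚ (1ℚ ℚ.- σ) *ℚ ℕ→ℚ (x i)
  term-≤ i = deficit-≤ {ℕ→ℚ n} nn≡N (ℕ→ℚ-nonNeg (n ∸ c i)) (ℕ→ℚ-mono-≤ (ℕP.m∸n≤m n (c i)))
               (ℕ→ℚ-nonNeg (x i))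
               (deficit-hypothesis (c≤n i) (hyp i)) 0≤σ σ≤1 X≤σσN (ℚP.<⇒≤ X<N)

lemma15 : (n : ℕ) → 1 ≤ n → (c x : Fin n → ℕ)
    → (∀ i → c i ≤ n) → (∀ i → x i ≤ n * n)
    → ratio (Σ x) (n * n) <ℚ 1ℚ
    → (∀ i → ((+ n -ℤ + c i) -ℤ + x i) *ℤ (+ n -ℤ + c i) ≤ℤ + Σ x)
    → (s s′ : ℚ) → 0ℚ ≤ℚ s → 0ℚ ≤ℚ s′
    → s *ℚ s ≤ℚ ratio (Σ x) (n * n) → ratio (Σ x) (n * n) ≤ℚ s′ *ℚ s′
    → bound n (Σ x) s ≤ℚ ℕ→ℚ (Σ c + Σ x) ⊎ bound n (Σ x) s′ ≤ℚ ℕ→ℚ (Σ c + Σ x)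
lemma15 zero () _ _ _ _ _ _ _ _ _ _ _ _
lemma15 n@(suc _) _ c x c≤n _ t<1 hyp s s′ _ 0≤s′ s*s≤t t≤s′*s′ =
  Sum.map (bound≤ s) (bound≤ s′)
    (deficitBound-cases {u = u} (ℕ→ℚ-nonNeg N) (ℕ→ℚ-mono-≤ (subst (A ≤_) A+C≡N (ℕP.m≤m+n A C)))
      (p*p<1⇒p≤1 (ℚP.≤-<-trans s*s≤t t<1))
      (λ s′≤1 → Σ-deficit-≤ n c x {u} c≤n hyp (ℕ→ℚ-mono-< X<N) (ratio-*-complement X<N)
                 0≤s′ s′≤1 (ratio≤⇒≤* X z<s t≤s′*s′)))
  where
  N = n * n
  X = Σ x
  C = Σ c
  A = Σ (λ i → n ∸ c i)
  t = ratio X N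
  u = ratio X (N ∸ X)
  A+C≡N : A + C ≡ N
  A+C≡N = Σ-∸+Σ n c c≤n
  X<N : X < N
  X<N = ratio<1⇒< X z<s t<1
  bound≤ : ∀ σ → ℕ→ℚ A ≤ℚ deficitBound (ℕ→ℚ N) u σ → bound n X σ ≤ℚ ℕ→ℚ (C + X)
  bound≤ σ = subst (bound n X σ ≤ℚ_) (sym (ℕ→ℚ-homo-+ C X))
           ∘ deficit≤⇒bound≤ {ℕ→ℚ N} {ℕ→ℚ A} {ℕ→ℚ C} {ℕ→ℚ X} {t} {u} {ℕ→ℚ (2 * n)} σ
               (trans (sym (ℕ→ℚ-homo-+ A C)) (cong ℕ→ℚ A+C≡N)) (ratio-*-denominator X z<s)
               (ratio-*-complement X<N) (ℕ→ℚ-nonNeg (2 * n))
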